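{- Let $n\ge2$ and let $w\in W(\widetilde{C}_n)$ be fully commutative. Suppose that $w$ has a reduced expression containing, as a consecutive subword, one of the following: (i) $s_2s_1s_2s_3\cdots s_{n-1}s_ns_{n+1}s_n$; (ii) $s_ns_{n+1}s_ns_{n-1}\cdots s_3s_2s_1s_2$; (iii) $s_1s_2\cdots s_ns_{n+1}s_n\cdots s_2s_1$; (iv) $s_{n+1}s_n\cdots s_2s_1s_2\cdots s_ns_{n+1}$. Then $w$ is of type I.
   Context: $W(\widetilde{C}_n)$ has generators $s_1,\dots,s_{n+1}$ with $m(s_1,s_2)=m(s_n,s_{n+1})=4$, $m(s_i,s_{i+1})=3$ for $1<i<n$, $m(s_i,s_j)=2$ for $|i-j|\ge2$. An element is fully commutative if any two of its reduced expressions are related by moves $st\mapsto ts$ with $m(s,t)=2$. For $i<j$, $\mathsf{z}_{i,j}=s_i\cdots s_j$, $\mathsf{z}_{j,i}=s_j\cdots s_i$, $\mathsf{z}_{i,i}=s_i$. $\mathsf{z}^{L,2k}_{i,j}=\mathsf{z}_{i,2}(\mathsf{z}_{1,n}\mathsf{z}_{n+1,2})^{k-1}\mathsf{z}_{1,n}\mathsf{z}_{n+1,j}$ ($1<i,j\le n+1$); $\mathsf{z}^{L,2k+1}_{i,j}=\mathsf{z}_{i,2}(\mathsf{z}_{1,n}\mathsf{z}_{n+1,2})^{k}\mathsf{z}_{1,j}$ ($1<i\le n+1$, $1\le j<n+1$); $\mathsf{z}^{R,2k}_{i,j}=\mathsf{z}_{i,n}(\mathsf{z}_{n+1,2}\mathsf{z}_{1,n})^{k-1}\mathsf{z}_{n+1,2}\mathsf{z}_{1,j}$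 ($1\le i,j<n+1$); $\mathsf{z}^{R,2k+1}_{i,j}=\mathsf{z}_{i,n}(\mathsf{z}_{n+1,2}\mathsf{z}_{1,n})^{k}\mathsf{z}_{n+1,j}$ ($1\le i<n+1$, $1<j\le n+1$). An element is of type I if it equals some $\mathsf{z}_{i,j}$, some $\mathsf{z}^{L,2k}_{i,j}$ or $\mathsf{z}^{R,2k}_{i,j}$ with $k\ge1$, or some $\mathsf{z}^{L,2k+1}_{i,j}$ or $\mathsf{z}^{R,2k+1}_{i,j}$ with $k\ge0$. -}

module Defs where

open import Data.Nat using (ℕ; zero; suc; _+_; _*_; _∸_; _≤_; _<_; _≤ᵇ_; _≡ᵇ_; ∣_-_∣)
open import Data.Bool using (if_then_else_; _∨_)
open import Data.List using (List; []; _∷_; _++_; length; map; upTo; concat; replicate)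
open import Data.List.Relation.Unary.All using (All)
open import Data.Product using (_×_; ∃; ∃-syntax; Σ-syntax)
open import Data.Sum using (_⊎_)
open import Relation.Binary.PropositionalEquality using (_≡_; _≢_)
open import Relation.Binary.Construct.Closure.Equivalence using (EqClosure)

-- Generators s_1 .. s_{n+1} of W(C̃_n) are encoded by the naturals 1 .. n+1;
-- a word (expression) is a list of such indices.
Gen : ℕ → ℕ → Set
Gen n s = 1 ≤ s × s ≤ suc n

Valid : ℕ → List ℕ → Set
Valid n = All (Gen n)

-- Coxeter matrix of type C̃_n (for generators in range)
m : ℕ → ℕ → ℕ → ℕ
m n i j =
  if i ≡ᵇ j then 1
  else if 2 ≤ᵇ ∣ i - j ∣ then 2
  else if (i + j ≡ᵇ 3) ∨ (i + j ≡ᵇ 2 * n + 1) then 4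
  else 3

alt : ℕ → ℕ → ℕ → List ℕ
alt s t zero = []
alt s t (suc k) = s ∷ alt t s k

data Step (n : ℕ) : List ℕ → List ℕ → Set where
  sq    : ∀ u v s → Gen n s → Step n (u ++ s ∷ s ∷ v) (u ++ v)
  braid : ∀ u v s t → Gen n s → Gen n t → s ≢ t →
          Step n (u ++ alt s t (m n s t) ++ v) (u ++ alt t s (m n s t) ++ v)

_≈[_]_ : List ℕ → ℕ → List ℕ → Set
a ≈[ n ] b = EqClosure (Step n) a b

Reduced : ℕ → List ℕ → List ℕ → Set
Reduced n a w = a ≈[ n ] w × (∀ c → c ≈[ n ] w → length a ≤ length c)

data CommStep (n : ℕ) : List ℕ → List ℕ → Set where
  comm : ∀ u v s t → Gen n s → Gen n t → m n s t ≡ 2 →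
         CommStep n (u ++ s ∷ t ∷ v) (u ++ t ∷ s ∷ v)

CommEq : ℕ → List ℕ → List ℕ → Set
CommEq n = EqClosure (CommStep n)

FullyCommutative : ℕ → List ℕ → Set
FullyCommutative n w = ∀ a b → Reduced n a w → Reduced n b w → CommEq n a b

z : ℕ → ℕ → List ℕ
z i j = if i ≤ᵇ j then map (λ t → i + t) (upTo (suc (j ∸ i)))
        else map (λ t → i ∸ t) (upTo (suc (i ∸ j)))

pow : ℕ → List ℕ → List ℕ
pow k l = concat (replicate k l)

zL2 zL1 zR2 zR1 : ℕ → ℕ → ℕ → ℕ → List ℕ
zL2 n k i j = z i 2 ++ pow (k ∸ 1) (z 1 n ++ z (suc n) 2) ++ z 1 n ++ z (suc n) j
zL1 n k i j = z i 2 ++ pow k (z 1 n ++ z (suc n) 2) ++ z 1 j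
zR2 n k i j = z i n ++ pow (k ∸ 1) (z (suc n) 2 ++ z 1 n) ++ z (suc n) 2 ++ z 1 j
zR1 n k i j = z i n ++ pow k (z (suc n) 2 ++ z 1 n) ++ z (suc n) j

TypeI : ℕ → List ℕ → Set
TypeI n w =
    (∃[ i ] ∃[ j ] (Gen n i × Gen n j × w ≈[ n ] z i j))
  ⊎ (∃[ k ] ∃[ i ] ∃[ j ] (1 ≤ k × 1 < i × i ≤ suc n × 1 < j × j ≤ suc n × w ≈[ n ] zL2 n k i j))
  ⊎ (∃[ k ] ∃[ i ] ∃[ j ] (1 ≤ k × 1 ≤ i × i < suc n × 1 ≤ j × j < suc n × w ≈[ n ] zR2 n k i j))
  ⊎ (∃[ k ] ∃[ i ] ∃[ j ] (1 < i × i ≤ suc n × 1 ≤ j × j < suc n × w ≈[ n ] zL1 n k i j))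
  ⊎ (∃[ k ] ∃[ i ] ∃[ j ] (1 ≤ i × i < suc n × 1 < j × j ≤ suc n × w ≈[ n ] zR1 n k i j))

Pattern : ℕ → List ℕ → Set
Pattern n p =
    p ≡ 2 ∷ z 1 (suc n) ++ n ∷ []
  ⊎ p ≡ n ∷ z (suc n) 1 ++ 2 ∷ []
  ⊎ p ≡ z 1 (suc n) ++ z n 1
  ⊎ p ≡ z (suc n) 1 ++ z 2 (suc n)

-- The patterns (i)–(iv) are segments of the periodic word s₁ s₂ ⋯ sₙ sₙ₊₁ sₙ ⋯ s₂ s₁ s₂ ⋯
-- that still contain every generator after their first or their last letter is removed.
-- In a reduced expression of a fully commutative element, the letter just before such a
-- segment must be the preceding letter of the periodic word: any other letter can be
-- commuted to the right until it meets a copy of itself, contradicting reducedness, or a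
-- neighbour, and then the segment supplies a braid sts or stst, which no reduced expression
-- of a fully commutative element contains.  So the segment grows to the left, and (reversing
-- all words) to the right, until it is the whole reduced expression; and the segments of the
-- periodic word are exactly the type I words.

module Submission where

open import Defs
open import Data.Nat using (ℕ; zero; suc; s≤s⁻¹; _+_; _*_; _∸_; _≤_; _<_; _≤ᵇ_; _≡ᵇ_; z≤n; s≤s; _≟_)
open import Data.Nat.Properties
open import Data.Bool using (true; false)
open import Data.Bool.Properties using (T-≡; ¬-not)
open import Data.List using (List; []; _∷_; _++_; _∷ʳ_; length; reverse; filter; applyUpTo)
open import Data.List.Properties
  using (++-assoc; ++-identityʳ; ++-cancelˡ; ++-cancelʳ; ∷-injectiveˡ; ∷-injectiveʳ; ∷ʳ-injective; length-++;
         applyUpTo-∷ʳ; map-applyUpTo; unfold-reverse; reverse-++; reverse-involutive; length-reverse;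
         filter-++; filter-all; filter-accept; filter-reject)
open import Data.List.Membership.Propositional using (_∈_)
open import Data.List.Membership.Propositional.Properties using (∈-applyUpTo⁺)
open import Data.List.Reverse using (Reverse; []; _∶_∶ʳ_; reverseView)
open import Data.List.Relation.Unary.Any using (here; there)
open import Data.List.Relation.Unary.All using (All; []; _∷_; tabulate; lookup)
import Data.List.Relation.Unary.Any.Properties as Any
open import Data.List.Relation.Unary.All.Properties using (++⁺; ++⁻ˡ; ++⁻ʳ)
open import Data.Product using (_×_; _,_; proj₁; ∃-syntax)
open import Data.Sum using (_⊎_; inj₁; inj₂)
open import Data.Empty using (⊥-elim)
open import Function using (id; _⇔_; mk⇔; Equivalence)
open import Function.Properties.Equivalence using (⇔-isEquivalence)
open import Relation.Nullary using (¬_; Dec; yes; no; _⊎-dec_)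
open import Relation.Binary.Definitions using (tri<; tri≈; tri>)
open import Relation.Binary.PropositionalEquality
open import Relation.Binary.Construct.Closure.ReflexiveTransitive using (ε; _◅_)
open import Relation.Binary.Construct.Closure.Symmetric using (fwd)
open import Relation.Binary.Construct.Closure.Equivalence as EqClosure using (gfold; gmap)

private
  variable
    n k s t : ℕ
    a b c u v w x y : List ℕ

≡ᵇ-refl : ∀ i → (i ≡ᵇ i) ≡ true
≡ᵇ-refl i = Equivalence.to T-≡ (≡⇒≡ᵇ i i refl)

≢⇒≡ᵇ-false : ∀ {i j} → i ≢ j → (i ≡ᵇ j) ≡ false
≢⇒≡ᵇ-false {i} {j} i≢j = ¬-not (λ e → i≢j (≡ᵇ⇒≡ i j (Equivalence.from T-≡ e)))

≤⇒≤ᵇ-true : ∀ {i j} → i ≤ j → (i ≤ᵇ j) ≡ true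
≤⇒≤ᵇ-true i≤j = Equivalence.to T-≡ (≤⇒≤ᵇ i≤j)

>⇒≤ᵇ-false : ∀ {i j} → j < i → (i ≤ᵇ j) ≡ false
>⇒≤ᵇ-false {i} {j} j<i = ¬-not (λ e → <⇒≱ j<i (≤ᵇ⇒≤ i j (Equivalence.from T-≡ e)))

m-sym : ∀ n i j → m n i j ≡ m n j i
m-sym n i j with i ≟ j
... | yes refl = refl
... | no i≢j rewrite ≢⇒≡ᵇ-false i≢j | ≢⇒≡ᵇ-false (≢-sym i≢j) | ∣-∣-comm i j | +-comm i j = refl

m-diag : ∀ n i → m n i i ≡ 1
m-diag n i rewrite ≡ᵇ-refl i = refl

m-far : ∀ n {i j} → 2 + i ≤ j → m n i j ≡ 2
m-far n {i} {j} 2+i≤j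
  rewrite ≢⇒≡ᵇ-false (<⇒≢ (≤-trans (n≤1+n _) 2+i≤j))
        | m≤n⇒∣m-n∣≡n∸m (≤-trans (≤-trans (n≤1+n i) (n≤1+n _)) 2+i≤j)
        | ≤⇒≤ᵇ-true (m+n≤o⇒m≤o∸n 2 {i} 2+i≤j) = refl

odd-injective : ∀ i j → i + suc i ≡ 2 * j + 1 → i ≡ j
odd-injective i j e = *-cancelˡ-≡ i j 2 (+-cancelʳ-≡ 1 (2 * i) (2 * j) (trans (sym (i+1+i i)) e))
  where
  i+1+i : ∀ i → i + suc i ≡ 2 * i + 1
  i+1+i i = begin
    i + suc i   ≡⟨ +-suc i i ⟩
    suc (i + i) ≡⟨ cong (λ l → suc (i + l)) (sym (+-identityʳ i)) ⟩
    suc (2 * i) ≡⟨ +-comm 1 (2 * i) ⟩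
    2 * i + 1   ∎
    where open ≡-Reasoning

End : ℕ → ℕ → Set
End n i = i ≡ 1 ⊎ i ≡ suc n

m-succ : ∀ n i → m n i (suc i) ≡ 3 ⊎ (m n i (suc i) ≡ 4 × (i ≡ 1 ⊎ i ≡ n))
m-succ n i
  rewrite ≢⇒≡ᵇ-false (<⇒≢ (n<1+n i)) | m≤n⇒∣m-n∣≡n∸m (n≤1+n i) | m+n∸n≡m 1 i
  with i + suc i ≡ᵇ 3 in at-1 | i + suc i ≡ᵇ 2 * n + 1 in at-n
... | true  | _     = inj₂ (refl , inj₁ (odd-injective i 1 (≡ᵇ⇒≡ _ _ (Equivalence.from T-≡ at-1))))
... | false | true  = inj₂ (refl , inj₂ (odd-injective i n (≡ᵇ⇒≡ _ _ (Equivalence.from T-≡ at-n))))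
... | false | false = inj₁ refl

Adjacent : ℕ → ℕ → Set
Adjacent i j = j ≡ suc i ⊎ i ≡ suc j

Adjacent⇒≢ : ∀ {i j} → Adjacent i j → i ≢ j
Adjacent⇒≢ (inj₁ refl) = <⇒≢ (n<1+n _)
Adjacent⇒≢ (inj₂ refl) = ≢-sym (<⇒≢ (n<1+n _))

m-adjacent : ∀ n {i j} → Adjacent i j → m n i j ≡ 3 ⊎ (m n i j ≡ 4 × (End n i ⊎ End n j))
m-adjacent n {i} (inj₁ refl) with m-succ n i
... | inj₁ e             = inj₁ e
... | inj₂ (e , inj₁ i≡1) = inj₂ (e , inj₁ (inj₁ i≡1))
... | inj₂ (e , inj₂ i≡n) = inj₂ (e , inj₂ (inj₂ (cong suc i≡n)))
m-adjacent n {j = j} (inj₂ refl) rewrite m-sym n (suc j) j with m-succ n j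
... | inj₁ e             = inj₁ e
... | inj₂ (e , inj₁ j≡1) = inj₂ (e , inj₂ (inj₁ j≡1))
... | inj₂ (e , inj₂ j≡n) = inj₂ (e , inj₁ (inj₂ (cong suc j≡n)))

data Relative (n i j : ℕ) : Set where
  identical : i ≡ j → Relative n i j
  adjacent  : Adjacent i j → Relative n i j
  commuting : i ≢ j → m n i j ≡ 2 → Relative n i j

relative : ∀ n i j → Relative n i j
relative n i j with <-cmp i j
... | tri≈ _ i≡j _ = identical i≡j
... | tri< i<j _ _ with m≤n⇒m<n∨m≡n i<j
...   | inj₁ 1+i<j = commuting (<⇒≢ i<j) (m-far n 1+i<j)
...   | inj₂ 1+i≡j = adjacent (inj₁ (sym 1+i≡j))
relative n i j | tri> _ _ j<i with m≤n⇒m<n∨m≡n j<i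
...   | inj₁ 1+j<i = commuting (≢-sym (<⇒≢ j<i)) (trans (m-sym n i j) (m-far n 1+j<i))
...   | inj₂ 1+j≡i = adjacent (inj₂ (sym 1+j≡i))

m-values : ∀ n {i j} → i ≢ j → m n i j ≡ 2 ⊎ m n i j ≡ 3 ⊎ m n i j ≡ 4
m-values n {i} {j} i≢j with relative n i j
... | identical i≡j   = ⊥-elim (i≢j i≡j)
... | commuting _ e   = inj₁ e
... | adjacent i~j with m-adjacent n i~j
...   | inj₁ e       = inj₂ (inj₁ e)
...   | inj₂ (e , _) = inj₂ (inj₂ e)

step-≈ : Step n a b → a ≈[ n ] b
step-≈ st = fwd st ◅ ε

sym-≈ : a ≈[ n ] b → b ≈[ n ] a
sym-≈ = EqClosure.symmetric _

trans-≈ : a ≈[ n ] b → b ≈[ n ] c → a ≈[ n ] c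
trans-≈ = EqClosure.transitive _

braid-≈ : ∀ u v → Gen n s → Gen n t → s ≢ t → m n s t ≡ k →
          (u ++ alt s t k ++ v) ≈[ n ] (u ++ alt t s k ++ v)
braid-≈ u v gs gt s≢t refl = step-≈ (braid u v _ _ gs gt s≢t)

length-alt : ∀ s t k → length (alt s t k) ≡ k
length-alt s t zero    = refl
length-alt s t (suc k) = cong suc (length-alt t s k)

length-++-middle : ∀ u v → length b ≡ length c → length (u ++ b ++ v) ≡ length (u ++ c ++ v)
length-++-middle {b = b} {c} u v e
  rewrite length-++ u {b ++ v} | length-++ u {c ++ v} | length-++ b {v} | length-++ c {v} | e = refl

Reduced-≈ : Reduced n a w → a ≈[ n ] b → length b ≤ length a → Reduced n b w
Reduced-≈ (a≈w , minimal) a≈b shorter = trans-≈ (sym-≈ a≈b) a≈w , λ c c≈w → ≤-trans shorter (minimal c c≈w)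

Reduced-minimal : Reduced n a w → a ≈[ n ] b → length a ≤ length b
Reduced-minimal (a≈w , minimal) a≈b = minimal _ (trans-≈ (sym-≈ a≈b) a≈w)

Reduced-braid : ∀ u v → Gen n s → Gen n t → s ≢ t → m n s t ≡ k →
                Reduced n (u ++ alt s t k ++ v) w → Reduced n (u ++ alt t s k ++ v) w
Reduced-braid {s = s} {t} {k} u v gs gt s≢t e r =
  Reduced-≈ r (braid-≈ u v gs gt s≢t e)
    (≤-reflexive (length-++-middle u v (trans (length-alt t s k) (sym (length-alt s t k)))))

Reduced-commute : ∀ u v → Gen n s → Gen n t → s ≢ t → m n s t ≡ 2 →
                  Reduced n (u ++ s ∷ t ∷ v) w → Reduced n (u ++ t ∷ s ∷ v) w
Reduced-commute = Reduced-braid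

Reduced-no-square : ∀ u v → Gen n s → ¬ Reduced n (u ++ s ∷ s ∷ v) w
Reduced-no-square {s = s} u v gs r = <⇒≱ shorter (Reduced-minimal r (step-≈ (sq u v s gs)))
  where
  shorter : length (u ++ v) < length (u ++ s ∷ s ∷ v)
  shorter rewrite length-++ u {v} | length-++ u {s ∷ s ∷ v} = +-monoʳ-< (length u) (m<n⇒m<1+n (n<1+n _))

All-alt : ∀ {P : ℕ → Set} → P s → P t → All P (alt s t k)
All-alt {k = zero}  ps pt = []
All-alt {k = suc k} ps pt = ps ∷ All-alt pt ps

All-++-middle : ∀ {P : ℕ → Set} u v → (All P b → All P c) → All P (u ++ b ++ v) → All P (u ++ c ++ v)
All-++-middle {b = b} u v f h = ++⁺ (++⁻ˡ u h) (++⁺ (f (++⁻ˡ b (++⁻ʳ u h))) (++⁻ʳ b (++⁻ʳ u h)))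

Valid-Step : Step n a b → Valid n a ⇔ Valid n b
Valid-Step (sq u v s gs) =
  mk⇔ (All-++-middle {b = s ∷ s ∷ []} u v λ _ → []) (All-++-middle u v λ _ → gs ∷ gs ∷ [])
Valid-Step (braid u v s t gs gt _) =
  mk⇔ (All-++-middle u v λ _ → All-alt gt gs) (All-++-middle u v λ _ → All-alt gs gt)

Valid-≈ : a ≈[ n ] b → Valid n b → Valid n a
Valid-≈ {n = n} a≈b = Equivalence.from (gfold ⇔-isEquivalence (Valid n) Valid-Step a≈b)

Reduced-Valid : Valid n w → Reduced n a w → Valid n a
Reduced-Valid vw (a≈w , _) = Valid-≈ a≈w vw

-- Commutations never swap s and t when m(s,t) ≥ 3, so the subword on {s, t} is invariant
-- under CommEq, while a braid move s t s ⋯ ↦ t s t ⋯ changes it.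
module Restriction (n s t : ℕ) (long : 3 ≤ m n s t) where

  Involved : ℕ → Set
  Involved i = i ≡ s ⊎ i ≡ t

  involved? : ∀ i → Dec (Involved i)
  involved? i = i ≟ s ⊎-dec i ≟ t

  restrict : List ℕ → List ℕ
  restrict = filter involved?

  not-both-involved : ∀ {i j} → Involved i → Involved j → m n i j ≢ 2
  not-both-involved (inj₁ refl) (inj₁ refl) e = <⇒≢ (n<1+n 1) (trans (sym (m-diag n s)) e)
  not-both-involved (inj₂ refl) (inj₂ refl) e = <⇒≢ (n<1+n 1) (trans (sym (m-diag n t)) e)
  not-both-involved (inj₁ refl) (inj₂ refl) e = <⇒≢ long (sym e)
  not-both-involved (inj₂ refl) (inj₁ refl) e = <⇒≢ long (sym (trans (m-sym n s t) e))

  restrict-CommStep : CommStep n a b → restrict a ≡ restrict b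
  restrict-CommStep (comm u v i j _ _ e)
    rewrite filter-++ involved? u (i ∷ j ∷ v) | filter-++ involved? u (j ∷ i ∷ v)
    = cong (restrict u ++_) (swap (involved? i) (involved? j))
    where
    swap : Dec (Involved i) → Dec (Involved j) → restrict (i ∷ j ∷ v) ≡ restrict (j ∷ i ∷ v)
    swap (yes pi) (yes pj) = ⊥-elim (not-both-involved pi pj e)
    swap (yes pi) (no ¬pj) = begin
      restrict (i ∷ j ∷ v) ≡⟨ filter-accept involved? pi ⟩
      i ∷ restrict (j ∷ v) ≡⟨ cong (i ∷_) (filter-reject involved? ¬pj) ⟩
      i ∷ restrict v       ≡⟨ sym (filter-accept involved? pi) ⟩
      restrict (i ∷ v)     ≡⟨ sym (filter-reject involved? ¬pj) ⟩
      restrict (j ∷ i ∷ v) ∎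
      where open ≡-Reasoning
    swap (no ¬pi) (yes pj) = begin
      restrict (i ∷ j ∷ v) ≡⟨ filter-reject involved? ¬pi ⟩
      restrict (j ∷ v)     ≡⟨ filter-accept involved? pj ⟩
      j ∷ restrict v       ≡⟨ cong (j ∷_) (sym (filter-reject involved? ¬pi)) ⟩
      j ∷ restrict (i ∷ v) ≡⟨ sym (filter-accept involved? pj) ⟩
      restrict (j ∷ i ∷ v) ∎
      where open ≡-Reasoning
    swap (no ¬pi) (no ¬pj) = trans (filter-reject involved? ¬pi) (trans (filter-reject involved? ¬pj)
                               (sym (trans (filter-reject involved? ¬pj) (filter-reject involved? ¬pi))))

  restrict-CommEq : CommEq n a b → restrict a ≡ restrict b
  restrict-CommEq = gfold isEquivalence restrict restrict-CommStep

  restrict-involved : ∀ u v → All Involved b → restrict (u ++ b ++ v) ≡ restrict u ++ b ++ restrict v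
  restrict-involved {b} u v all-involved
    rewrite filter-++ involved? u (b ++ v) | filter-++ involved? b v
          | filter-all involved? all-involved = refl

long-braid-not-reduced : FullyCommutative n w → Gen n s → Gen n t → s ≢ t → m n s t ≡ k → 3 ≤ k →
                         ¬ Reduced n (x ++ alt s t k ++ y) w
long-braid-not-reduced {n} {s = s} {t} {suc k} {x} {y} fc gs gt s≢t e 3≤k r =
  s≢t (∷-injectiveˡ (++-cancelʳ (restrict y) _ _ (++-cancelˡ (restrict x) _ _ restricted)))
  where
  open Restriction n s t (≤-trans 3≤k (≤-reflexive (sym e)))
  restricted : restrict x ++ alt s t (suc k) ++ restrict y ≡ restrict x ++ alt t s (suc k) ++ restrict y
  restricted = begin
    restrict x ++ alt s t (suc k) ++ restrict y ≡⟨ sym (restrict-involved x y (All-alt (inj₁ refl) (inj₂ refl))) ⟩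
    restrict (x ++ alt s t (suc k) ++ y)        ≡⟨ restrict-CommEq (fc _ _ r (Reduced-braid x y gs gt s≢t e r)) ⟩
    restrict (x ++ alt t s (suc k) ++ y)        ≡⟨ restrict-involved x y (All-alt (inj₂ refl) (inj₁ refl)) ⟩
    restrict x ++ alt t s (suc k) ++ restrict y ∎
    where open ≡-Reasoning

∈-tail : ∀ {i j} {l : List ℕ} → i ≢ j → i ∈ j ∷ l → i ∈ l
∈-tail i≢j (here i≡j) = ⊥-elim (i≢j i≡j)
∈-tail i≢j (there i∈) = i∈

reverse-++-++ : ∀ (u b v : List ℕ) → reverse (u ++ b ++ v) ≡ reverse v ++ reverse b ++ reverse u
reverse-++-++ u b v =
  trans (reverse-++ u (b ++ v)) (trans (cong (_++ reverse u) (reverse-++ b v)) (++-assoc (reverse v) (reverse b) (reverse u)))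

reverse-braid-≈ : ∀ u v → Gen n s → Gen n t → s ≢ t → m n s t ≡ k →
                  (u ++ reverse (alt s t k) ++ v) ≈[ n ] (u ++ reverse (alt t s k) ++ v)
reverse-braid-≈ {n} {s} {t} u v gs gt s≢t e with m-values n s≢t
... | inj₁ e₂         rewrite sym e | e₂ = braid-≈ u v gt gs (≢-sym s≢t) (trans (m-sym n t s) e₂)
... | inj₂ (inj₁ e₃) rewrite sym e | e₃ = braid-≈ u v gs gt s≢t e₃
... | inj₂ (inj₂ e₄) rewrite sym e | e₄ = braid-≈ u v gt gs (≢-sym s≢t) (trans (m-sym n t s) e₄)

reverse-Step : Step n a b → reverse a ≈[ n ] reverse b
reverse-Step (sq u v s gs) rewrite reverse-++-++ u (s ∷ s ∷ []) v | reverse-++ u v =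
  step-≈ (sq (reverse v) (reverse u) s gs)
reverse-Step {n} (braid u v s t gs gt s≢t)
  rewrite reverse-++-++ u (alt s t (m n s t)) v | reverse-++-++ u (alt t s (m n s t)) v =
  reverse-braid-≈ (reverse v) (reverse u) gs gt s≢t refl

reverse-≈ : a ≈[ n ] b → reverse a ≈[ n ] reverse b
reverse-≈ {n = n} = gfold (EqClosure.isEquivalence (Step n)) reverse reverse-Step

reverse-CommStep : CommStep n a b → CommStep n (reverse a) (reverse b)
reverse-CommStep {n} (comm u v s t gs gt e)
  rewrite reverse-++-++ u (s ∷ t ∷ []) v | reverse-++-++ u (t ∷ s ∷ []) v =
  comm (reverse v) (reverse u) t s gt gs (trans (m-sym n t s) e)

reverse-CommEq : CommEq n a b → CommEq n (reverse a) (reverse b)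
reverse-CommEq = gmap reverse reverse-CommStep

reverse-Reduced : Reduced n a w → Reduced n (reverse a) (reverse w)
reverse-Reduced {n} {a} {w} (a≈w , minimal) = reverse-≈ a≈w , λ c c≈rw →
  subst₂ _≤_ (sym (length-reverse a)) (length-reverse c)
    (minimal (reverse c) (subst (reverse c ≈[ n ]_) (reverse-involutive w) (reverse-≈ c≈rw)))

reverse-Reduced⁻ : Reduced n a (reverse w) → Reduced n (reverse a) w
reverse-Reduced⁻ {n} {a} {w} r = subst (Reduced n (reverse a)) (reverse-involutive w) (reverse-Reduced r)

reverse-FullyCommutative : FullyCommutative n w → FullyCommutative n (reverse w)
reverse-FullyCommutative {n} fc a b ra rb = subst₂ (CommEq n) (reverse-involutive a) (reverse-involutive b)
  (reverse-CommEq (fc (reverse a) (reverse b) (reverse-Reduced⁻ ra) (reverse-Reduced⁻ rb)))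

reverse-Valid : Valid n w → Valid n (reverse w)
reverse-Valid valid = tabulate λ i∈ → lookup valid (Any.reverse⁻ i∈)

applyUpTo-cong : ∀ {f g : ℕ → ℕ} → (∀ t → f t ≡ g t) → ∀ d → applyUpTo f d ≡ applyUpTo g d
applyUpTo-cong f≗g zero    = refl
applyUpTo-cong f≗g (suc d) = cong₂ _∷_ (f≗g 0) (applyUpTo-cong (λ t → f≗g (suc t)) d)

z-ascending : ∀ {i j} → i ≤ j → z i j ≡ applyUpTo (i +_) (suc (j ∸ i))
z-ascending {i} i≤j rewrite ≤⇒≤ᵇ-true i≤j = map-applyUpTo id (i +_) _

z-single : ∀ i → z i i ≡ i ∷ []
z-single i rewrite z-ascending (≤-refl {i}) | n∸n≡0 i = cong (_∷ []) (+-identityʳ i)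

z-descending : ∀ {i j} → j ≤ i → z i j ≡ applyUpTo (i ∸_) (suc (i ∸ j))
z-descending {i} j≤i with m≤n⇒m<n∨m≡n j≤i
... | inj₂ refl = trans (z-single i) (cong (λ d → applyUpTo (i ∸_) (suc d)) (sym (n∸n≡0 i)))
... | inj₁ j<i rewrite >⇒≤ᵇ-false j<i = map-applyUpTo id (i ∸_) _

z-ascending-∷ : ∀ {i j} → i < j → z i j ≡ i ∷ z (suc i) j
z-ascending-∷ {i} i<j rewrite z-ascending (<⇒≤ i<j) | z-ascending i<j | +-∸-assoc 1 i<j =
  cong₂ _∷_ (+-identityʳ i) (applyUpTo-cong (+-suc i) _)

z-descending-∷ : ∀ {i j} → j ≤ i → z (suc i) j ≡ suc i ∷ z i j
z-descending-∷ j≤i rewrite z-descending (m≤n⇒m≤1+n j≤i) | z-descending j≤i | +-∸-assoc 1 j≤i = refl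

z-ascending-∷ʳ : ∀ {i j} → i ≤ j → z i j ∷ʳ suc j ≡ z i (suc j)
z-ascending-∷ʳ {i} {j} i≤j rewrite z-ascending i≤j | z-ascending (m≤n⇒m≤1+n i≤j) | +-∸-assoc 1 i≤j =
  trans (cong (applyUpTo (i +_) (suc (j ∸ i)) ∷ʳ_) (sym last)) (applyUpTo-∷ʳ (i +_) (suc (j ∸ i)))
  where
  last : i + suc (j ∸ i) ≡ suc j
  last = trans (+-suc i (j ∸ i)) (cong suc (m+[n∸m]≡n i≤j))

z-descending-∷ʳ : ∀ {i j} → suc j ≤ i → z i (suc j) ∷ʳ j ≡ z i j
z-descending-∷ʳ {i} {j} j<i = begin
  z i (suc j) ∷ʳ j                        ≡⟨ cong (_∷ʳ j) (z-descending j<i) ⟩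
  applyUpTo (i ∸_) (suc d) ∷ʳ j           ≡⟨ cong (applyUpTo (i ∸_) (suc d) ∷ʳ_) (sym last) ⟩
  applyUpTo (i ∸_) (suc d) ∷ʳ (i ∸ suc d) ≡⟨ applyUpTo-∷ʳ (i ∸_) (suc d) ⟩
  applyUpTo (i ∸_) (suc (suc d))          ≡⟨ cong (λ e → applyUpTo (i ∸_) (suc e)) (sym (+-∸-assoc 1 j<i)) ⟩
  applyUpTo (i ∸_) (suc (i ∸ j))          ≡⟨ sym (z-descending (<⇒≤ j<i)) ⟩
  z i j                                   ∎
  where
  open ≡-Reasoning
  d = i ∸ suc j
  last : i ∸ suc d ≡ j
  last = trans (cong (i ∸_) (sym (+-∸-assoc 1 j<i))) (m∸[m∸n]≡n (<⇒≤ j<i))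

∈-z-ascending : ∀ {i j a} → i ≤ a → a ≤ j → a ∈ z i j
∈-z-ascending {i} i≤a a≤j rewrite z-ascending (≤-trans i≤a a≤j) =
  subst (_∈ _) (m+[n∸m]≡n i≤a) (∈-applyUpTo⁺ (i +_) (s≤s (∸-monoˡ-≤ i a≤j)))

∈-z-descending : ∀ {i j a} → j ≤ a → a ≤ i → a ∈ z i j
∈-z-descending {i} j≤a a≤i rewrite z-descending (≤-trans j≤a a≤i) =
  subst (_∈ _) (m∸[m∸n]≡n a≤i) (∈-applyUpTo⁺ (i ∸_) (s≤s (∸-monoʳ-≤ i j≤a)))

pow-++ : ∀ k (l : List ℕ) → pow k l ++ l ≡ pow (suc k) l
pow-++ zero    l = sym (++-identityʳ l)
pow-++ (suc k) l = trans (++-assoc l (pow k l) l) (cong (l ++_) (pow-++ k l))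

module Zigzag (n : ℕ) (2≤n : 2 ≤ n) where

  1≤n : 1 ≤ n
  1≤n = ≤-trans (n≤1+n 1) 2≤n

  -- up c and down c are the letter s_c on an ascending and on a descending run of the
  -- periodic word; states that are not Proper are junk.
  data State : Set where
    up down : ℕ → State

  Proper : State → Set
  Proper (up c)   = 1 ≤ c × c ≤ n
  Proper (down c) = 2 ≤ c × c ≤ suc n

  letter : State → ℕ
  letter (up c)   = c
  letter (down c) = c

  next : State → State
  next (up c) with c ≟ n
  ... | yes _ = down (suc n)
  ... | no _  = up (suc c)
  next (down (suc (suc (suc c)))) = down (suc (suc c))
  next (down _)                   = up 1

  prev : State → State
  prev (up (suc (suc c))) = up (suc c)
  prev (up _)             = down 2
  prev (down c) with c ≟ suc n
  ... | yes _ = up n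
  ... | no _  = down (suc c)

  walk : State → ℕ → List ℕ
  walk st zero    = []
  walk st (suc L) = letter st ∷ walk (next st) L

  Gen-letter : ∀ st → Proper st → Gen n (letter st)
  Gen-letter (up c)   (1≤c , c≤n) = 1≤c , m≤n⇒m≤1+n c≤n
  Gen-letter (down c) (2≤c , c≤1+n) = ≤-trans (n≤1+n 1) 2≤c , c≤1+n

  Proper-next : ∀ st → Proper st → Proper (next st)
  Proper-next (up c) (1≤c , c≤n) with c ≟ n
  ... | yes _   = m≤n⇒m≤1+n 2≤n , ≤-refl
  ... | no c≢n  = s≤s z≤n , ≤∧≢⇒< c≤n c≢n
  Proper-next (down (suc (suc zero))) _                  = ≤-refl , 1≤n
  Proper-next (down (suc zero)) (s≤s () , _)
  Proper-next (down zero) (() , _)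
  Proper-next (down (suc (suc (suc c)))) (_ , c≤1+n)     = s≤s (s≤s z≤n) , ≤-trans (n≤1+n _) c≤1+n

  Proper-prev : ∀ st → Proper st → Proper (prev st)
  Proper-prev (up (suc zero))       _             = ≤-refl , m≤n⇒m≤1+n 2≤n
  Proper-prev (up (suc (suc c)))    (_ , c≤n)     = s≤s z≤n , ≤-trans (n≤1+n _) c≤n
  Proper-prev (down c) (2≤c , c≤1+n) with c ≟ suc n
  ... | yes _    = 1≤n , ≤-refl
  ... | no c≢1+n = s≤s (≤-trans (n≤1+n 1) 2≤c) , ≤∧≢⇒< c≤1+n c≢1+n

  next-prev : ∀ st → Proper st → next (prev st) ≡ st
  next-prev (up (suc zero)) _ = refl
  next-prev (up (suc (suc c))) (_ , c≤n) with suc c ≟ n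
  ... | yes 1+c≡n = ⊥-elim (<⇒≢ c≤n 1+c≡n)
  ... | no _      = refl
  next-prev (down c) (2≤c , _) with c ≟ suc n
  next-prev (down c) _ | yes refl with n ≟ n
  ... | yes _  = refl
  ... | no n≢n = ⊥-elim (n≢n refl)
  next-prev (down (suc (suc c))) _ | no _ = refl
  next-prev (down (suc zero)) (s≤s () , _) | no _
  next-prev (down zero) (() , _) | no _

  prev-next : ∀ st → Proper st → prev (next st) ≡ st
  prev-next (up c) (1≤c , _) with c ≟ n
  prev-next (up c) _ | yes refl with suc n ≟ suc n
  ... | yes _      = refl
  ... | no 1+n≢1+n = ⊥-elim (1+n≢1+n refl)
  prev-next (up (suc c)) _ | no _ = refl
  prev-next (down (suc (suc zero))) _ = refl
  prev-next (down (suc zero)) (s≤s () , _)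
  prev-next (down zero) (() , _)
  prev-next (down (suc (suc (suc c)))) (_ , c≤1+n) with suc (suc c) ≟ suc n
  ... | yes 2+c≡1+n = ⊥-elim (<⇒≢ c≤1+n 2+c≡1+n)
  ... | no _        = refl

  letter-next-up : ∀ c → letter (next (up c)) ≡ suc c
  letter-next-up c with c ≟ n
  ... | yes refl = refl
  ... | no _     = refl

  letter-next-down : ∀ c → 1 ≤ c → letter (next (down (suc c))) ≡ c
  letter-next-down (suc zero)    _ = refl
  letter-next-down (suc (suc c)) _ = refl

  neighbours : ∀ st {i} → Proper st → Gen n i → Adjacent i (letter st) → i ≡ letter (prev st) ⊎ i ≡ letter (next st)
  neighbours (up _) {suc zero}    _ _ (inj₁ refl) = inj₁ refl
  neighbours (up _) {suc (suc i)} _ _ (inj₁ refl) = inj₁ refl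
  neighbours (up _) {zero} _ (() , _) (inj₁ refl)
  neighbours (up c)   _ _ (inj₂ refl) = inj₂ (sym (letter-next-up c))
  neighbours (down _) {i} _ (1≤i , _) (inj₁ refl) = inj₂ (sym (letter-next-down i 1≤i))
  neighbours (down c) (_ , c≤1+n) (_ , i≤1+n) (inj₂ refl) with c ≟ suc n
  ... | yes refl = ⊥-elim (<⇒≱ (n<1+n _) i≤1+n)
  ... | no _     = inj₁ refl

  next-down : ∀ {c} → 2 ≤ c → next (down (suc c)) ≡ down c
  next-down {suc (suc c)} _ = refl
  next-down {suc zero} (s≤s ())

  end-turn : ∀ st → Proper st → End n (letter st) → letter (prev st) ≡ letter (next st)
  end-turn (up _)   _ (inj₁ refl) = sym (letter-next-up 1)
  end-turn (up _)   (_ , c≤n) (inj₂ refl) = ⊥-elim (<⇒≱ (n<1+n n) c≤n)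
  end-turn (down _) (s≤s () , _) (inj₁ refl)
  end-turn (down _) _ (inj₂ refl) with suc n ≟ suc n
  ... | yes _      = sym (letter-next-down n 1≤n)
  ... | no 1+n≢1+n = ⊥-elim (1+n≢1+n refl)

  -- Read backwards, ascending runs become descending ones; s₁ and sₙ₊₁ are turning points.
  flip : State → State
  flip (up (suc zero)) = up 1
  flip (up c)          = down c
  flip (down c) with c ≟ suc n
  ... | yes _ = down c
  ... | no _  = up c

  flip-up : ∀ {c} → 2 ≤ c → flip (up c) ≡ down c
  flip-up {suc (suc c)} _ = refl
  flip-up {suc zero} (s≤s ())

  letter-flip : ∀ st → letter (flip st) ≡ letter st
  letter-flip (up zero)          = refl
  letter-flip (up (suc zero))    = refl
  letter-flip (up (suc (suc c))) = refl
  letter-flip (down c) with c ≟ suc n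
  ... | yes _ = refl
  ... | no _  = refl

  Proper-flip : ∀ st → Proper st → Proper (flip st)
  Proper-flip (up (suc zero))    _           = ≤-refl , 1≤n
  Proper-flip (up (suc (suc c))) (_ , c≤n)   = s≤s (s≤s z≤n) , m≤n⇒m≤1+n c≤n
  Proper-flip (down c) (2≤c , c≤1+n) with c ≟ suc n
  ... | yes _    = 2≤c , c≤1+n
  ... | no c≢1+n = ≤-trans (n≤1+n 1) 2≤c , s≤s⁻¹ (≤∧≢⇒< c≤1+n c≢1+n)

  next-flip : ∀ st → Proper st → next (flip st) ≡ flip (prev st)
  next-flip (up (suc zero)) _ with 1 ≟ n | 2 ≟ suc n
  ... | no _    | no _     = refl
  ... | yes 1≡n | _        = ⊥-elim (<⇒≢ 2≤n 1≡n)
  ... | _       | yes 2≡1+n = ⊥-elim (<⇒≢ (s≤s 2≤n) 2≡1+n)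
  next-flip (up (suc (suc zero)))    _ = refl
  next-flip (up (suc (suc (suc c)))) _ = refl
  next-flip (down c) _ with c ≟ suc n
  ... | yes refl = trans (next-down 2≤n) (sym (flip-up 2≤n))
  ... | no c≢1+n with c ≟ n | suc c ≟ suc n
  ...   | yes refl | yes _      = refl
  ...   | no _    | no _        = refl
  ...   | yes c≡n | no 1+c≢1+n  = ⊥-elim (1+c≢1+n (cong suc c≡n))
  ...   | no c≢n  | yes 1+c≡1+n = ⊥-elim (c≢n (suc-injective 1+c≡1+n))

  advance : ℕ → State → State
  advance zero    st = st
  advance (suc k) st = advance k (next st)

  advance-next : ∀ k st → advance k (next st) ≡ next (advance k st)
  advance-next zero    st = refl
  advance-next (suc k) st = advance-next k (next st)

  Proper-advance : ∀ k st → Proper st → Proper (advance k st)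
  Proper-advance zero    st p = p
  Proper-advance (suc k) st p = Proper-advance k (next st) (Proper-next st p)

  prev-advance : ∀ k st → Proper st → prev (advance (suc k) st) ≡ advance k st
  prev-advance k st p = trans (cong prev (advance-next k st)) (prev-next (advance k st) (Proper-advance k st p))

  walk-∷ʳ : ∀ L st → walk st (suc L) ≡ walk st L ∷ʳ letter (advance L st)
  walk-∷ʳ zero    st = refl
  walk-∷ʳ (suc L) st = cong (letter st ∷_) (walk-∷ʳ L (next st))

  walk-prev : ∀ L st → Proper st → walk (prev st) (suc L) ≡ letter (prev st) ∷ walk st L
  walk-prev L st p = cong (λ st′ → letter (prev st) ∷ walk st′ L) (next-prev st p)

  advance-flip : ∀ L st → Proper st → advance (suc L) (flip (advance L st)) ≡ flip (prev st)
  advance-flip zero    st p = next-flip st p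
  advance-flip (suc L) st p = begin
    advance (suc L) (next (flip (advance L (next st)))) ≡⟨ advance-next (suc L) (flip (advance L (next st))) ⟩
    next (advance (suc L) (flip (advance L (next st)))) ≡⟨ cong next (advance-flip L (next st) (Proper-next st p)) ⟩
    next (flip (prev (next st)))                        ≡⟨ cong (λ st′ → next (flip st′)) (prev-next st p) ⟩
    next (flip st)                                      ≡⟨ next-flip st p ⟩
    flip (prev st)                                      ∎
    where open ≡-Reasoning

  reverse-walk : ∀ L st → Proper st → reverse (walk st (suc L)) ≡ walk (flip (advance L st)) (suc L)
  reverse-walk zero    st p = cong (_∷ []) (sym (letter-flip st))
  reverse-walk (suc L) st p = begin
    reverse (letter st ∷ walk (next st) (suc L))  ≡⟨ unfold-reverse (letter st) (walk (next st) (suc L)) ⟩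
    reverse (walk (next st) (suc L)) ∷ʳ letter st ≡⟨ cong (_∷ʳ letter st) (reverse-walk L (next st) (Proper-next st p)) ⟩
    walk F (suc L) ∷ʳ letter st                   ≡⟨ cong (walk F (suc L) ∷ʳ_) last-letter ⟩
    walk F (suc L) ∷ʳ letter (advance (suc L) F)  ≡⟨ sym (walk-∷ʳ (suc L) F) ⟩
    walk F (suc (suc L))                          ∎
    where
    open ≡-Reasoning
    F = flip (advance L (next st))
    last-letter : letter st ≡ letter (advance (suc L) F)
    last-letter = sym (begin
      letter (advance (suc L) F)     ≡⟨ cong letter (advance-flip L (next st) (Proper-next st p)) ⟩
      letter (flip (prev (next st))) ≡⟨ cong (λ st′ → letter (flip st′)) (prev-next st p) ⟩
      letter (flip st)               ≡⟨ letter-flip st ⟩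
      letter st                      ∎)

  Covering : List ℕ → Set
  Covering l = ∀ i → Gen n i → i ∈ l

  Gen-1 : Gen n 1
  Gen-1 = ≤-refl , s≤s z≤n

  Saturated : State → ℕ → Set
  Saturated st L = Proper st × Covering (walk st (L ∸ 1)) × Covering (walk (next st) (L ∸ 1))

  Saturated-prev : ∀ st L → Saturated st L → Saturated (prev st) (suc L)
  Saturated-prev st zero (_ , covers-init , _) with covers-init 1 Gen-1
  ... | ()
  Saturated-prev st (suc L) (p , covers-init , covers-tail) =
    Proper-prev st p ,
    (λ i gi → subst (i ∈_) (sym (walk-prev L st p)) (there (covers-init i gi))) ,
    (λ i gi → subst (λ st′ → i ∈ walk st′ (suc L)) (sym (next-prev st p)) (there (covers-tail i gi)))

  Covering-reverse : ∀ {l l′} → reverse l ≡ l′ → Covering l → Covering l′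
  Covering-reverse refl covers i gi = Any.reverse⁺ (covers i gi)

  SaturatedWalk : List ℕ → Set
  SaturatedWalk l = ∃[ st ] ∃[ L ] (Saturated st L × l ≡ walk st L)

  reverse-SaturatedWalk : ∀ {l} → SaturatedWalk l → SaturatedWalk (reverse l)
  reverse-SaturatedWalk (st , zero , (_ , covers-init , _) , _) with covers-init 1 Gen-1
  ... | ()
  reverse-SaturatedWalk (st , suc zero , (_ , _ , covers-tail) , _) with covers-tail 1 Gen-1
  ... | ()
  reverse-SaturatedWalk (st , suc (suc L) , (p , covers-init , covers-tail) , refl) =
    st′ , suc (suc L) , (Proper-flip _ (Proper-advance (suc L) st p) , covers-init′ , covers-tail′) ,
    reverse-walk (suc L) st p
    where
    st′ = flip (advance (suc L) st)
    covers-init′ : Covering (walk st′ (suc L))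
    covers-init′ = Covering-reverse (reverse-walk L (next st) (Proper-next st p)) covers-tail
    flip-next : flip (advance L st) ≡ next st′
    flip-next = begin
      flip (advance L st)              ≡⟨ cong flip (sym (prev-advance L st p)) ⟩
      flip (prev (advance (suc L) st)) ≡⟨ sym (next-flip _ (Proper-advance (suc L) st p)) ⟩
      next st′                         ∎
      where open ≡-Reasoning
    covers-tail′ : Covering (walk (next st′) (suc L))
    covers-tail′ = Covering-reverse (trans (reverse-walk L st p) (cong (λ st″ → walk st″ (suc L)) flip-next)) covers-init

  module Extension (w : List ℕ) (valid : Valid n w) (fc : FullyCommutative n w) where

    adjacent-letter-not-reduced :
      ∀ L st x y {i} → Proper st → Gen n i → Adjacent i (letter st) → i ≢ letter (prev st) →
      i ≡ letter (next st) → i ∈ walk st (suc L) → ¬ Reduced n (x ++ i ∷ walk st (2 + L) ++ y) w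
    adjacent-letter-not-reduced zero st x y p gi i~b i≢prev i≡next (here i≡b) r = Adjacent⇒≢ i~b i≡b
    adjacent-letter-not-reduced (suc L) st x y p gi i~b i≢prev refl _ r with m-adjacent n i~b
    ... | inj₁ e₃ = long-braid-not-reduced fc gi (Gen-letter st p) (Adjacent⇒≢ i~b) e₃ ≤-refl r
    ... | inj₂ (_ , inj₂ b-end) = i≢prev (sym (end-turn st p b-end))
    ... | inj₂ (e₄ , inj₁ i-end) =
      long-braid-not-reduced fc gi (Gen-letter st p) (Adjacent⇒≢ i~b) e₄ (n≤1+n 3)
        (subst (λ c → Reduced n (x ++ i′ ∷ letter st ∷ i′ ∷ c ∷ walk (next (next (next st))) L ++ y) w)
               (sym b≡next²) r)
      where
      i′ = letter (next st)
      b≡next² : letter st ≡ letter (next (next st))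
      b≡next² = trans (cong letter (sym (prev-next st p))) (end-turn (next st) (Proper-next st p) i-end)

    -- The stray letter i is commuted rightwards along the walk.  As it occurs in the walk
    -- before the last letter, it meets a copy of itself (a square) or a neighbour b, and then
    -- the walk continues into a braid i b i or i b i b.
    Stray : ℕ → Set
    Stray L = ∀ st x y {i} → Proper st → Gen n i → i ≢ letter (prev st) →
              i ∈ walk st (L ∸ 1) → ¬ Reduced n (x ++ i ∷ walk st L ++ y) w

    stray-step : ∀ L → Stray (suc L) → Stray (2 + L)
    stray-step L stray st x y {i} p gi i≢prev i∈ r with relative n i (letter st)
    ... | identical refl = Reduced-no-square x (walk (next st) (suc L) ++ y) gi r
    ... | commuting i≢b e =
      stray (next st) (x ++ letter st ∷ []) y (Proper-next st p) gi
        (subst (λ st′ → i ≢ letter st′) (sym (prev-next st p)) i≢b) (∈-tail i≢b i∈)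
        (subst (λ l → Reduced n l w) (sym (++-assoc x (letter st ∷ []) _))
          (Reduced-commute x _ gi (Gen-letter st p) i≢b e r))
    ... | adjacent i~b with neighbours st p gi i~b
    ...   | inj₁ i≡prev = i≢prev i≡prev
    ...   | inj₂ i≡next = adjacent-letter-not-reduced L st x y p gi i~b i≢prev i≡next i∈ r

    stray-letter-not-reduced : ∀ L → Stray L
    stray-letter-not-reduced zero          _ _ _ _ _ _ () _
    stray-letter-not-reduced (suc zero)    _ _ _ _ _ _ () _
    stray-letter-not-reduced (suc (suc L)) = stray-step L (stray-letter-not-reduced (suc L))

    letter-before-walk : ∀ L st x y {i} → Proper st → Gen n i → i ∈ walk st (L ∸ 1) →
                         Reduced n (x ++ i ∷ walk st L ++ y) w → i ≡ letter (prev st)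
    letter-before-walk L st x y {i} p gi i∈ r with i ≟ letter (prev st)
    ... | yes i≡prev = i≡prev
    ... | no i≢prev  = ⊥-elim (stray-letter-not-reduced L st x y p gi i≢prev i∈ r)

    walk-grows-left : ∀ x y {i st L} → Saturated st L → Reduced n (x ++ i ∷ walk st L ++ y) w →
                      i ∷ walk st L ≡ walk (prev st) (suc L)
    walk-grows-left x y {i} {st} {L} (p , covers-init , _) r =
      trans (cong (_∷ walk st L) (letter-before-walk L st x y p gi (covers-init i gi) r)) (sym (walk-prev L st p))
      where
      gi : Gen n i
      gi with ++⁻ʳ x (Reduced-Valid valid r)
      ... | g ∷ _ = g

    extend-left′ : ∀ {x a} → Reverse x → ∀ y → SaturatedWalk a → Reduced n (x ++ a ++ y) w → SaturatedWalk (x ++ a)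
    extend-left′ [] y sw r = sw
    extend-left′ (x ∶ rx ∶ʳ i) y (st , L , sat , refl) r =
      subst SaturatedWalk (sym (++-assoc x (i ∷ []) (walk st L)))
        (extend-left′ rx y (prev st , suc L , Saturated-prev st L sat , walk-grows-left x y sat r′) r′)
      where
      r′ : Reduced n (x ++ i ∷ walk st L ++ y) w
      r′ = subst (λ l → Reduced n l w) (++-assoc x (i ∷ []) _) r

    extend-left : ∀ {a} x y → SaturatedWalk a → Reduced n (x ++ a ++ y) w → SaturatedWalk (x ++ a)
    extend-left x = extend-left′ (reverseView x)

  extend-right : ∀ {w a} → Valid n w → FullyCommutative n w → ∀ v →
                 SaturatedWalk a → Reduced n (a ++ v) w → SaturatedWalk (a ++ v)
  extend-right {w} {a} valid fc v sw r =
    subst SaturatedWalk reverse-reverse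
      (reverse-SaturatedWalk
        (Extension.extend-left (reverse w) (reverse-Valid valid) (reverse-FullyCommutative fc) (reverse v) []
          (reverse-SaturatedWalk sw) (subst (λ l → Reduced n l (reverse w)) reversed (reverse-Reduced r))))
    where
    reversed : reverse (a ++ v) ≡ reverse v ++ reverse a ++ []
    reversed = trans (reverse-++ a v) (cong (reverse v ++_) (sym (++-identityʳ _)))
    reverse-reverse : reverse (reverse v ++ reverse a) ≡ a ++ v
    reverse-reverse = trans (reverse-++ (reverse v) (reverse a)) (cong₂ _++_ (reverse-involutive a) (reverse-involutive v))

  reduced-expression-is-walk : ∀ {w p} → Valid n w → FullyCommutative n w → ∀ u v →
                               SaturatedWalk p → Reduced n (u ++ p ++ v) w → SaturatedWalk (u ++ p ++ v)
  reduced-expression-is-walk {w} {p} valid fc u v sw r =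
    subst SaturatedWalk (++-assoc u p v)
      (extend-right valid fc v (Extension.extend-left w valid fc u v sw r)
        (subst (λ l → Reduced n l w) (sym (++-assoc u p v)) r))

  walk-induction : ∀ (P : List ℕ → State → Set) st → P (letter st ∷ []) st →
                   (∀ {l st′} → P l st′ → P (l ∷ʳ letter (next st′)) (next st′)) →
                   ∀ L → P (walk st (suc L)) (advance L st)
  walk-induction P st start step zero    = start
  walk-induction P st start step (suc L) =
    subst₂ P (sym (trans (walk-∷ʳ (suc L) st) (cong (λ st′ → walk st (suc L) ∷ʳ letter st′) (advance-next L st))))
             (sym (advance-next L st)) (step (walk-induction P st start step L))

  X Y : List ℕ
  X = z 1 n ++ z (suc n) 2
  Y = z (suc n) 2 ++ z 1 n

  data WalkFromDown (i : ℕ) : List ℕ → State → Set where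
    z-shape   : ∀ j → 2 ≤ j → j ≤ i → WalkFromDown i (z i j) (down j)
    zL1-shape : ∀ k j → 1 ≤ j → j ≤ n → WalkFromDown i (zL1 n k i j) (up j)
    zL2-shape : ∀ k j → 2 ≤ j → j ≤ suc n → WalkFromDown i (zL2 n (suc k) i j) (down j)

  data WalkFromUp (i : ℕ) : List ℕ → State → Set where
    z-shape   : ∀ j → i ≤ j → j ≤ n → WalkFromUp i (z i j) (up j)
    zR2-shape : ∀ k j → 1 ≤ j → j ≤ n → WalkFromUp i (zR2 n (suc k) i j) (up j)
    zR1-shape : ∀ k j → 2 ≤ j → j ≤ suc n → WalkFromUp i (zR1 n k i j) (down j)

  ∷ʳ-++ : ∀ (a : List ℕ) {b b′ i} → b ∷ʳ i ≡ b′ → (a ++ b) ∷ʳ i ≡ a ++ b′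
  ∷ʳ-++ a {b} {i = i} e = trans (++-assoc a b (i ∷ [])) (cong (a ++_) e)

  WalkFromDown-step : ∀ {i l st} → WalkFromDown i l st → WalkFromDown i (l ∷ʳ letter (next st)) (next st)
  WalkFromDown-step (z-shape zero () _)
  WalkFromDown-step (z-shape (suc zero) (s≤s ()) _)
  WalkFromDown-step (zL2-shape _ zero () _)
  WalkFromDown-step (zL2-shape _ (suc zero) (s≤s ()) _)
  WalkFromDown-step (z-shape (suc (suc zero)) _ _) = zL1-shape 0 1 ≤-refl 1≤n
  WalkFromDown-step {i} (z-shape (suc (suc (suc j))) _ j≤i) =
    subst (λ l → WalkFromDown i l (down (suc (suc j)))) (sym (z-descending-∷ʳ j≤i))
      (z-shape (suc (suc j)) (s≤s (s≤s z≤n)) (≤-trans (n≤1+n _) j≤i))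
  WalkFromDown-step {i} (zL1-shape k j 1≤j j≤n) with j ≟ n
  ... | yes refl = subst (λ l → WalkFromDown i l (down (suc j)))
                     (sym (∷ʳ-++ (z i 2) (∷ʳ-++ (pow k X) (cong (z 1 j ++_) (sym (z-single (suc j)))))))
                     (zL2-shape k (suc j) (s≤s 1≤j) ≤-refl)
  ... | no j≢n   = subst (λ l → WalkFromDown i l (up (suc j)))
                     (sym (∷ʳ-++ (z i 2) (∷ʳ-++ (pow k X) (z-ascending-∷ʳ 1≤j))))
                     (zL1-shape k (suc j) (s≤s z≤n) (≤∧≢⇒< j≤n j≢n))
  WalkFromDown-step {i} (zL2-shape k (suc (suc zero)) _ _) =
    subst (λ l → WalkFromDown i l (up 1)) (sym (∷ʳ-++ (z i 2) (cong (_∷ʳ 1) (pow-++ k X))))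
      (zL1-shape (suc k) 1 ≤-refl 1≤n)
  WalkFromDown-step {i} (zL2-shape k (suc (suc (suc j))) _ j≤1+n) =
    subst (λ l → WalkFromDown i l (down (suc (suc j))))
      (sym (∷ʳ-++ (z i 2) (∷ʳ-++ (pow k X) (∷ʳ-++ (z 1 n) (z-descending-∷ʳ j≤1+n)))))
      (zL2-shape k (suc (suc j)) (s≤s (s≤s z≤n)) (≤-trans (n≤1+n _) j≤1+n))

  WalkFromUp-step : ∀ {i l st} → 1 ≤ i → WalkFromUp i l st → WalkFromUp i (l ∷ʳ letter (next st)) (next st)
  WalkFromUp-step {i} 1≤i (z-shape j i≤j j≤n) with j ≟ n
  ... | yes refl = subst (λ l → WalkFromUp i l (down (suc j))) (cong (z i j ++_) (z-single (suc j)))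
                     (zR1-shape 0 (suc j) (s≤s (≤-trans 1≤i i≤j)) ≤-refl)
  ... | no j≢n   = subst (λ l → WalkFromUp i l (up (suc j))) (sym (z-ascending-∷ʳ i≤j))
                     (z-shape (suc j) (m≤n⇒m≤1+n i≤j) (≤∧≢⇒< j≤n j≢n))
  WalkFromUp-step _ (zR1-shape _ zero () _)
  WalkFromUp-step _ (zR1-shape _ (suc zero) (s≤s ()) _)
  WalkFromUp-step {i} _ (zR1-shape k (suc (suc zero)) _ _) =
    subst (λ l → WalkFromUp i l (up 1)) (sym (∷ʳ-++ (z i n) (∷ʳ-++ (pow k Y) refl))) (zR2-shape k 1 ≤-refl 1≤n)
  WalkFromUp-step {i} _ (zR1-shape k (suc (suc (suc j))) _ j≤1+n) =
    subst (λ l → WalkFromUp i l (down (suc (suc j))))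
      (sym (∷ʳ-++ (z i n) (∷ʳ-++ (pow k Y) (z-descending-∷ʳ j≤1+n))))
      (zR1-shape k (suc (suc j)) (s≤s (s≤s z≤n)) (≤-trans (n≤1+n _) j≤1+n))
  WalkFromUp-step {i} _ (zR2-shape k j 1≤j j≤n) with j ≟ n
  ... | yes refl = subst (λ l → WalkFromUp i l (down (suc j)))
                     (sym (∷ʳ-++ (z i j) (trans (cong (_∷ʳ suc j) (pow-++ k Y))
                                                (cong (pow (suc k) Y ++_) (sym (z-single (suc j)))))))
                     (zR1-shape (suc k) (suc j) (s≤s 1≤n) ≤-refl)
  ... | no j≢n   = subst (λ l → WalkFromUp i l (up (suc j)))
                     (sym (∷ʳ-++ (z i n) (∷ʳ-++ (pow k Y) (∷ʳ-++ (z (suc n) 2) (z-ascending-∷ʳ 1≤j)))))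
                     (zR2-shape k (suc j) (s≤s z≤n) (≤∧≢⇒< j≤n j≢n))

  WalkFromDown⇒TypeI : ∀ {w i l st} → 2 ≤ i → i ≤ suc n → WalkFromDown i l st → w ≈[ n ] l → TypeI n w
  WalkFromDown⇒TypeI {i = i} 2≤i i≤1+n (z-shape j 2≤j j≤i) w≈ =
    inj₁ (i , j , (≤-trans (n≤1+n 1) 2≤i , i≤1+n) , (≤-trans (n≤1+n 1) 2≤j , ≤-trans j≤i i≤1+n) , w≈)
  WalkFromDown⇒TypeI {i = i} 2≤i i≤1+n (zL2-shape k j 2≤j j≤1+n) w≈ =
    inj₂ (inj₁ (suc k , i , j , s≤s z≤n , 2≤i , i≤1+n , 2≤j , j≤1+n , w≈))
  WalkFromDown⇒TypeI {i = i} 2≤i i≤1+n (zL1-shape k j 1≤j j≤n) w≈ =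
    inj₂ (inj₂ (inj₂ (inj₁ (k , i , j , 2≤i , i≤1+n , 1≤j , s≤s j≤n , w≈))))

  WalkFromUp⇒TypeI : ∀ {w i l st} → 1 ≤ i → i ≤ n → WalkFromUp i l st → w ≈[ n ] l → TypeI n w
  WalkFromUp⇒TypeI {i = i} 1≤i i≤n (z-shape j i≤j j≤n) w≈ =
    inj₁ (i , j , (1≤i , m≤n⇒m≤1+n i≤n) , (≤-trans 1≤i i≤j , m≤n⇒m≤1+n j≤n) , w≈)
  WalkFromUp⇒TypeI {i = i} 1≤i i≤n (zR2-shape k j 1≤j j≤n) w≈ =
    inj₂ (inj₂ (inj₁ (suc k , i , j , s≤s z≤n , 1≤i , s≤s i≤n , 1≤j , s≤s j≤n , w≈)))
  WalkFromUp⇒TypeI {i = i} 1≤i i≤n (zR1-shape k j 2≤j j≤1+n) w≈ =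
    inj₂ (inj₂ (inj₂ (inj₂ (k , i , j , 1≤i , s≤s i≤n , 2≤j , j≤1+n , w≈))))

  SaturatedWalk-TypeI : ∀ {w a} → SaturatedWalk a → w ≈[ n ] a → TypeI n w
  SaturatedWalk-TypeI (st , zero , (_ , covers-init , _) , _) _ with covers-init 1 Gen-1
  ... | ()
  SaturatedWalk-TypeI (up i , suc L , ((1≤i , i≤n) , _) , refl) =
    WalkFromUp⇒TypeI 1≤i i≤n
      (walk-induction (WalkFromUp i) (up i)
        (subst (λ l → WalkFromUp i l (up i)) (z-single i) (z-shape i ≤-refl i≤n)) (WalkFromUp-step 1≤i) L)
  SaturatedWalk-TypeI (down i , suc L , ((2≤i , i≤1+n) , _) , refl) =
    WalkFromDown⇒TypeI 2≤i i≤1+n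
      (walk-induction (WalkFromDown i) (down i)
        (subst (λ l → WalkFromDown i l (down i)) (z-single i) (z-shape i 2≤i ≤-refl)) WalkFromDown-step L)

  walk-up-run : ∀ d {i} → i + d ≡ n → ∀ L → walk (up i) (suc d + L) ≡ z i n ++ walk (down (suc n)) L
  walk-up-run zero {i} i+0≡n L with i ≟ n
  ... | yes refl = cong (_++ walk (down (suc i)) L) (sym (z-single i))
  ... | no i≢n   = ⊥-elim (i≢n (trans (sym (+-identityʳ i)) i+0≡n))
  walk-up-run (suc d) {i} i+1+d≡n L with i ≟ n
  ... | yes refl = ⊥-elim (m+1+n≢m i i+1+d≡n)
  ... | no _     = trans (cong (i ∷_) (walk-up-run d (trans (sym (+-suc i d)) i+1+d≡n) L))
                         (cong (_++ walk (down (suc n)) L) (sym (z-ascending-∷ i<n)))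
    where
    i<n : i < n
    i<n = subst (i <_) i+1+d≡n (m<m+n i (s≤s z≤n))

  walk-down-run : ∀ d {i} → 2 + d ≡ i → ∀ L → walk (down i) (suc d + L) ≡ z i 2 ++ walk (up 1) L
  walk-down-run zero    refl L = refl
  walk-down-run (suc d) refl L =
    trans (cong (3 + d ∷_) (walk-down-run d refl L))
          (cong (_++ walk (up 1) L) (sym (z-descending-∷ (s≤s (s≤s z≤n)))))

  saturated-from : ∀ st L i M j → Proper st → walk st (suc L) ≡ i ∷ M ++ j ∷ [] →
                   Covering (i ∷ M) → Covering (M ++ j ∷ []) → Saturated st (suc L)
  saturated-from st L i M j p e covers-init covers-tail =
    p , subst Covering (sym init≡) covers-init , subst Covering (sym (∷-injectiveʳ e)) covers-tail
    where
    init≡ : walk st L ≡ i ∷ M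
    init≡ = proj₁ (∷ʳ-injective (walk st L) (i ∷ M) (trans (sym (walk-∷ʳ L st)) e))

  Covering-ascending : Covering (z 1 (suc n))
  Covering-ascending i (1≤i , i≤1+n) = ∈-z-ascending 1≤i i≤1+n

  Covering-descending : Covering (z (suc n) 1)
  Covering-descending i (1≤i , i≤1+n) = ∈-z-descending 1≤i i≤1+n

  -- Lengths are written with suc n′ (= n) so that walk unfolds.
  n′ : ℕ
  n′ = n ∸ 1

  1+n′≡n : 1 + n′ ≡ n
  1+n′≡n = m+[n∸m]≡n 1≤n

  saturated-pattern-i : SaturatedWalk (2 ∷ z 1 (suc n) ++ n ∷ [])
  saturated-pattern-i = down 2 , suc (suc n′ + 2) ,
    saturated-from (down 2) _ 2 (z 1 (suc n)) n (≤-refl , m≤n⇒m≤1+n 2≤n) (sym e)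
      (λ i gi → there (Covering-ascending i gi)) (λ i gi → Any.++⁺ˡ (Covering-ascending i gi)) ,
    e
    where
    e : 2 ∷ z 1 (suc n) ++ n ∷ [] ≡ walk (down 2) (suc (suc n′ + 2))
    e = cong (2 ∷_) (sym (begin
      walk (up 1) (suc n′ + 2)                           ≡⟨ walk-up-run n′ 1+n′≡n 2 ⟩
      z 1 n ++ suc n ∷ letter (next (down (suc n))) ∷ [] ≡⟨ cong (λ st → z 1 n ++ suc n ∷ letter st ∷ []) (next-down 2≤n) ⟩
      z 1 n ++ suc n ∷ n ∷ []                            ≡⟨ sym (++-assoc (z 1 n) (suc n ∷ []) (n ∷ [])) ⟩
      (z 1 n ∷ʳ suc n) ++ n ∷ []                         ≡⟨ cong (_++ n ∷ []) (z-ascending-∷ʳ 1≤n) ⟩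
      z 1 (suc n) ++ n ∷ []                              ∎))
      where open ≡-Reasoning

  saturated-pattern-ii : SaturatedWalk (n ∷ z (suc n) 1 ++ 2 ∷ [])
  saturated-pattern-ii = up n , suc (suc n′ + 2) ,
    saturated-from (up n) _ n (z (suc n) 1) 2 (1≤n , ≤-refl) (sym e)
      (λ i gi → there (Covering-descending i gi)) (λ i gi → Any.++⁺ˡ (Covering-descending i gi)) ,
    e
    where
    e : n ∷ z (suc n) 1 ++ 2 ∷ [] ≡ walk (up n) (suc (suc n′ + 2))
    e = sym (begin
      walk (up n) (suc (suc n′ + 2))            ≡⟨ walk-up-run 0 (+-identityʳ n) (suc n′ + 2) ⟩
      z n n ++ walk (down (suc n)) (suc n′ + 2) ≡⟨ cong₂ _++_ (z-single n) (walk-down-run n′ (cong suc 1+n′≡n) 2) ⟩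
      n ∷ z (suc n) 2 ++ walk (up 1) 2          ≡⟨ cong (λ c → n ∷ z (suc n) 2 ++ 1 ∷ c ∷ []) (letter-next-up 1) ⟩
      n ∷ z (suc n) 2 ++ 1 ∷ 2 ∷ []             ≡⟨ cong (n ∷_) (sym (++-assoc (z (suc n) 2) (1 ∷ []) (2 ∷ []))) ⟩
      n ∷ (z (suc n) 2 ∷ʳ 1) ++ 2 ∷ []          ≡⟨ cong (λ l → n ∷ l ++ 2 ∷ []) (z-descending-∷ʳ (s≤s 1≤n)) ⟩
      n ∷ z (suc n) 1 ++ 2 ∷ []                 ∎)
      where open ≡-Reasoning

  saturated-pattern-iii : SaturatedWalk (z 1 (suc n) ++ z n 1)
  saturated-pattern-iii = up 1 , suc n′ + (suc n′ + 1) ,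
    saturated-from (up 1) _ 1 M 1 (≤-refl , 1≤n) (sym walk≡) covers-init covers-tail , trans p≡ walk≡
    where
    open ≡-Reasoning
    M = z 2 (suc n) ++ z n 2
    p≡ : z 1 (suc n) ++ z n 1 ≡ 1 ∷ M ++ 1 ∷ []
    p≡ = begin
      z 1 (suc n) ++ z n 1               ≡⟨ cong₂ _++_ (z-ascending-∷ (s≤s 1≤n)) (sym (z-descending-∷ʳ 2≤n)) ⟩
      1 ∷ z 2 (suc n) ++ z n 2 ++ 1 ∷ [] ≡⟨ cong (1 ∷_) (sym (++-assoc (z 2 (suc n)) (z n 2) (1 ∷ []))) ⟩
      1 ∷ M ++ 1 ∷ []                    ∎
    walk≡ : 1 ∷ M ++ 1 ∷ [] ≡ walk (up 1) (suc n′ + (suc n′ + 1))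
    walk≡ = sym (begin
      walk (up 1) (suc n′ + (suc n′ + 1))       ≡⟨ walk-up-run n′ 1+n′≡n (suc n′ + 1) ⟩
      z 1 n ++ walk (down (suc n)) (suc n′ + 1) ≡⟨ cong (z 1 n ++_) (walk-down-run n′ (cong suc 1+n′≡n) 1) ⟩
      z 1 n ++ z (suc n) 2 ++ 1 ∷ []            ≡⟨ cong₂ (λ a b → a ++ b ++ 1 ∷ []) (z-ascending-∷ 2≤n) (z-descending-∷ 2≤n) ⟩
      1 ∷ z 2 n ++ suc n ∷ z n 2 ++ 1 ∷ []      ≡⟨ cong (1 ∷_) (sym (++-assoc (z 2 n) (suc n ∷ []) _)) ⟩
      1 ∷ (z 2 n ∷ʳ suc n) ++ z n 2 ++ 1 ∷ []   ≡⟨ cong (λ a → 1 ∷ a ++ z n 2 ++ 1 ∷ []) (z-ascending-∷ʳ 2≤n) ⟩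
      1 ∷ z 2 (suc n) ++ z n 2 ++ 1 ∷ []        ≡⟨ cong (1 ∷_) (sym (++-assoc (z 2 (suc n)) (z n 2) (1 ∷ []))) ⟩
      1 ∷ M ++ 1 ∷ []                           ∎)
    covers-init : Covering (1 ∷ M)
    covers-init i gi@(1≤i , i≤1+n) with i ≟ 1
    ... | yes i≡1 = here i≡1
    ... | no i≢1  = there (Any.++⁺ˡ (∈-z-ascending (≤∧≢⇒< 1≤i (≢-sym i≢1)) i≤1+n))
    covers-tail : Covering (M ++ 1 ∷ [])
    covers-tail i gi@(1≤i , i≤1+n) with i ≟ 1
    ... | yes i≡1 = Any.++⁺ʳ M (here i≡1)
    ... | no i≢1  = Any.++⁺ˡ (Any.++⁺ˡ (∈-z-ascending (≤∧≢⇒< 1≤i (≢-sym i≢1)) i≤1+n))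

  saturated-pattern-iv : SaturatedWalk (z (suc n) 1 ++ z 2 (suc n))
  saturated-pattern-iv = down (suc n) , suc n′ + (suc n′ + 1) ,
    saturated-from (down (suc n)) _ (suc n) M (suc n) (s≤s 1≤n , ≤-refl) (sym walk≡) covers-init covers-tail ,
    trans p≡ walk≡
    where
    open ≡-Reasoning
    M = z n 1 ++ z 2 n
    p≡ : z (suc n) 1 ++ z 2 (suc n) ≡ suc n ∷ M ++ suc n ∷ []
    p≡ = begin
      z (suc n) 1 ++ z 2 (suc n)           ≡⟨ cong₂ _++_ (z-descending-∷ 1≤n) (sym (z-ascending-∷ʳ 2≤n)) ⟩
      suc n ∷ z n 1 ++ z 2 n ++ suc n ∷ [] ≡⟨ cong (suc n ∷_) (sym (++-assoc (z n 1) (z 2 n) (suc n ∷ []))) ⟩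
      suc n ∷ M ++ suc n ∷ []              ∎
    walk≡ : suc n ∷ M ++ suc n ∷ [] ≡ walk (down (suc n)) (suc n′ + (suc n′ + 1))
    walk≡ = sym (begin
      walk (down (suc n)) (suc n′ + (suc n′ + 1)) ≡⟨ walk-down-run n′ (cong suc 1+n′≡n) (suc n′ + 1) ⟩
      z (suc n) 2 ++ walk (up 1) (suc n′ + 1)     ≡⟨ cong (z (suc n) 2 ++_) (walk-up-run n′ 1+n′≡n 1) ⟩
      z (suc n) 2 ++ z 1 n ++ suc n ∷ []          ≡⟨ cong₂ (λ a b → a ++ b ++ suc n ∷ []) (z-descending-∷ 2≤n) (z-ascending-∷ 2≤n) ⟩
      suc n ∷ z n 2 ++ 1 ∷ z 2 n ++ suc n ∷ []    ≡⟨ cong (suc n ∷_) (sym (++-assoc (z n 2) (1 ∷ []) _)) ⟩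
      suc n ∷ (z n 2 ∷ʳ 1) ++ z 2 n ++ suc n ∷ [] ≡⟨ cong (λ a → suc n ∷ a ++ z 2 n ++ suc n ∷ []) (z-descending-∷ʳ 2≤n) ⟩
      suc n ∷ z n 1 ++ z 2 n ++ suc n ∷ []        ≡⟨ cong (suc n ∷_) (sym (++-assoc (z n 1) (z 2 n) (suc n ∷ []))) ⟩
      suc n ∷ M ++ suc n ∷ []                     ∎)
    covers-init : Covering (suc n ∷ M)
    covers-init i gi@(1≤i , i≤1+n) with i ≟ suc n
    ... | yes i≡1+n = here i≡1+n
    ... | no i≢1+n  = there (Any.++⁺ˡ (∈-z-descending 1≤i (s≤s⁻¹ (≤∧≢⇒< i≤1+n i≢1+n))))
    covers-tail : Covering (M ++ suc n ∷ [])
    covers-tail i gi@(1≤i , i≤1+n) with i ≟ suc n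
    ... | yes i≡1+n = Any.++⁺ʳ M (here i≡1+n)
    ... | no i≢1+n  = Any.++⁺ˡ (Any.++⁺ˡ (∈-z-descending 1≤i (s≤s⁻¹ (≤∧≢⇒< i≤1+n i≢1+n))))

  Pattern-SaturatedWalk : ∀ {p} → Pattern n p → SaturatedWalk p
  Pattern-SaturatedWalk (inj₁ refl)               = saturated-pattern-i
  Pattern-SaturatedWalk (inj₂ (inj₁ refl))        = saturated-pattern-ii
  Pattern-SaturatedWalk (inj₂ (inj₂ (inj₁ refl))) = saturated-pattern-iii
  Pattern-SaturatedWalk (inj₂ (inj₂ (inj₂ refl))) = saturated-pattern-iv

lemma5p2 : (n : ℕ) → 2 ≤ n → (w : List ℕ) → Valid n w → FullyCommutative n w →
           (∃[ u ] ∃[ p ] ∃[ v ] (Pattern n p × Reduced n (u ++ p ++ v) w)) →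
           TypeI n w
lemma5p2 n 2≤n w valid fc (u , p , v , is-pattern , r) =
  SaturatedWalk-TypeI (reduced-expression-is-walk valid fc u v (Pattern-SaturatedWalk is-pattern) r) (sym-≈ (proj₁ r))
  where open Zigzag n 2≤n
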